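{- Let $\theta,\delta$ be congruences of $\mathbf{L}_n$, each with more than one class, such that $\theta\vee\delta\ne\{0,\dots,n\}^2$ and both $\mathsf{f}_\theta$ and $\mathsf{f}_\delta$ are even. Then $\mathrm{ext}(\theta)\cap\mathrm{ext}(\delta)\ne\{0,n\}$.
   Context: For an integer $n\ge 1$, the line $\mathbf{L}_n$ is the frame $\langle\{0,\dots,n\},R\rangle$ where $x\mathrel{R}y$ iff $|x-y|\le 1$. A congruence of $\mathbf{L}_n$ is an equivalence relation $\theta$ on $\{0,\dots,n\}$ such that whenever $x'\mathrel{\theta}x$ and $x\mathrel{R}y$ there is $y'$ with $x'\mathrel{R}y'$ and $y'\mathrel{\theta}y$; join = generated equivalence relation. The quotient of $\mathbf{L}_n$ by $\theta$ is isomorphic to a line; the step of $\theta$ is the number of classes minus one; $e$ is an extreme of $\theta$ if $e/\theta$ is an endpoint of the quotient line, $\mathrm{ext}(\theta)$ the set of extremes. A rest is a pair $\langle r,r+1\rangle\in\theta$. Frequency: $\mathsf{f}_\theta=(n-\#\text{rests})/\text{step}$. -}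

module Defs where

open import Data.Nat using (ℕ; zero; suc; _≤_; _<_; _∸_; _*_)
open import Data.Fin using (Fin; toℕ; inject₁; fromℕ)
open import Data.Bool using (Bool; true; false; T; not; _∧_; if_then_else_)
open import Data.Nat using (_<ᵇ_)
open import Data.List using (List; allFin)
open import Data.Product using (Σ; ∃; ∃-syntax; _×_)
open import Data.Sum using (_⊎_)
open import Relation.Binary.PropositionalEquality using (_≡_)
open import Relation.Binary.Construct.Closure.ReflexiveTransitive using (Star)
open import Function.Definitions using (Surjective)

-- Points of the line L_n are Fin (suc n), i.e. {0,…,n}.
-- The accessibility relation of L_n : x R y iff |x - y| ≤ 1.
Adj : ∀ {n} → Fin (suc n) → Fin (suc n) → Set
Adj x y = (toℕ x ≤ suc (toℕ y)) × (toℕ y ≤ suc (toℕ x))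

BRel : ℕ → Set
BRel n = Fin (suc n) → Fin (suc n) → Bool

_∋_~_ : ∀ {n} → BRel n → Fin (suc n) → Fin (suc n) → Set
θ ∋ x ~ y = T (θ x y)

record Congruence {n : ℕ} (θ : BRel n) : Set where
  field
    refl′  : ∀ x → θ ∋ x ~ x
    sym′   : ∀ {x y} → θ ∋ x ~ y → θ ∋ y ~ x
    trans′ : ∀ {x y z} → θ ∋ x ~ y → θ ∋ y ~ z → θ ∋ x ~ z
    back   : ∀ {x x′ y} → θ ∋ x′ ~ x → Adj x y → ∃[ y′ ] (Adj x′ y′ × (θ ∋ y′ ~ y))

-- Join of two equivalence relations: the generated equivalence relation,
-- i.e. the reflexive–transitive closure of the union (union is symmetric).
data Union {n : ℕ} (θ δ : BRel n) (x y : Fin (suc n)) : Set where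
  inl : θ ∋ x ~ y → Union θ δ x y
  inr : δ ∋ x ~ y → Union θ δ x y

Join : ∀ {n} → BRel n → BRel n → Fin (suc n) → Fin (suc n) → Set
Join θ δ = Star (Union θ δ)

JoinIsTotal : ∀ {n} → BRel n → BRel n → Set
JoinIsTotal {n} θ δ = ∀ (x y : Fin (suc n)) → Join θ δ x y

countB : ∀ {A : Set} → (A → Bool) → List A → ℕ
countB p List.[] = zero
countB p (x List.∷ xs) = if p x then suc (countB p xs) else countB p xs

allB : ∀ {A : Set} → (A → Bool) → List A → Bool
allB p List.[] = true
allB p (x List.∷ xs) = p x ∧ allB p xs

-- x is the least element of its θ-class
isLeader : ∀ {n} → BRel n → Fin (suc n) → Bool
isLeader {n} θ x = allB (λ y → not ((toℕ y <ᵇ toℕ x) ∧ θ y x)) (allFin (suc n))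

classes : ∀ {n} → BRel n → ℕ
classes {n} θ = countB (isLeader θ) (allFin (suc n))

step : ∀ {n} → BRel n → ℕ
step θ = classes θ ∸ 1

rests : ∀ {n} → BRel n → ℕ
rests {n} θ = countB (λ r → θ (inject₁ r) (Data.Fin.suc r)) (allFin n)

-- the frequency f_θ = (n - #rests)/step is an even integer
FreqEven : ∀ {n} → BRel n → Set
FreqEven {n} θ = ∃[ k ] (n ∸ rests θ ≡ step θ * (2 * k))

-- accessibility relation of the quotient frame L_n/θ, on representatives
QAdj : ∀ {n} → BRel n → Fin (suc n) → Fin (suc n) → Set
QAdj θ x y = ∃[ x′ ] ∃[ y′ ] ((θ ∋ x′ ~ x) × (θ ∋ y′ ~ y) × Adj x′ y′)

-- φ induces an isomorphism L_n/θ ≅ L_m  (x/θ ↦ φ x)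
record QuotIso {n : ℕ} (θ : BRel n) (m : ℕ) (φ : Fin (suc n) → Fin (suc m)) : Set where
  field
    onto     : ∀ (i : Fin (suc m)) → ∃[ x ] (φ x ≡ i)
    kernel   : ∀ x y → (θ ∋ x ~ y → φ x ≡ φ y) × (φ x ≡ φ y → θ ∋ x ~ y)
    preserve : ∀ x y → (QAdj θ x y → Adj (φ x) (φ y)) × (Adj (φ x) (φ y) → QAdj θ x y)

-- e is an extreme of θ: e/θ is an endpoint of the quotient line
Extreme : ∀ {n} → BRel n → Fin (suc n) → Set
Extreme θ e = ∃[ m ] ∃[ φ ] (QuotIso θ m φ × ((toℕ (φ e) ≡ 0) ⊎ (toℕ (φ e) ≡ m)))

ExtMeetIsEnds : ∀ {n} → BRel n → BRel n → Set
ExtMeetIsEnds {n} θ δ =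
  ∀ (e : Fin (suc n)) →
    ((Extreme θ e × Extreme δ e) → (e ≡ Data.Fin.zero ⊎ e ≡ fromℕ n)) ×
    ((e ≡ Data.Fin.zero ⊎ e ≡ fromℕ n) → (Extreme θ e × Extreme δ e))

module Submission where

-- Suppose ext θ ∩ ext δ = {0, n}.  A quotient map L_n → L_m read along the
-- line is a walk that moves by at most one and at interior values neither
-- rests nor turns back; reflecting, it starts at 0.  Counting its moves, it
-- sweeps 0 → m → 0 → …, so positions whose move counts sum to an even
-- multiple of m carry the same value.  As θ has m + 1 classes and its rests
-- are those of the walk, even frequency means 2k·m moves (sweep-form).  The
-- cuts of θ ∨ δ are moves of both walks and are placed symmetrically, so each
-- midpoint has half of the cuts before it, and there is a cut as θ ∨ δ is not
-- total.  Both midpoints lie in the block between the two middle cuts, where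
-- each midpoint level is an interval centred in the block (centred-level);
-- the intervals share a point strictly inside the line that is an extreme of
-- both congruences.

open import Data.Nat
open import Data.Nat.Properties
open import Data.Nat.Tactic.RingSolver using (solve-∀)
open import Data.Bool using (Bool; true; false; not; _∧_; T; if_then_else_)
open import Data.Sum using (_⊎_; inj₁; inj₂)
open import Data.Product using (∃-syntax; _×_; _,_; proj₁; proj₂)
open import Data.Empty using (⊥; ⊥-elim)
open import Data.Fin using (Fin; toℕ; fromℕ; fromℕ<; inject₁) renaming (zero to fzero; suc to fsuc)
open import Data.Fin.Properties using (toℕ-injective; toℕ<n; toℕ-fromℕ; toℕ-fromℕ<; toℕ-inject₁)
open import Data.List using (tabulate)
open import Relation.Binary.PropositionalEquality
open import Relation.Binary.Definitions using (tri<; tri≈; tri>)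
open import Relation.Binary.Construct.Closure.ReflexiveTransitive using (ε; _◅_; _◅◅_; reverse)
open import Relation.Nullary using (¬_; yes; no; Dec; does)
open import Relation.Nullary.Decidable.Core using (¬¬-excluded-middle)
open import Defs

double-multiple≤⇒0 : ∀ j m → j * m + j * m ≤ m → j * m ≡ 0
double-multiple≤⇒0 zero    m _ = refl
double-multiple≤⇒0 (suc j) m h = trans (cong (suc j *_) m≡0) (*-zeroʳ (suc j))
  where
  m≤jm : m ≤ suc j * m
  m≤jm = m≤m+n m (j * m)
  m≡0 : m ≡ 0
  m≡0 = n≤0⇒n≡0 (+-cancelˡ-≤ m m 0 (begin
    m + m                 ≤⟨ +-mono-≤ m≤jm m≤jm ⟩
    suc j * m + suc j * m ≤⟨ h ⟩
    m                     ≡⟨ +-identityʳ m ⟨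
    m + 0                 ∎))
    where open ≤-Reasoning

offset-of-multiple : ∀ m x y a → a ≤ m → x * m + a ≡ y * m → a ≡ 0 ⊎ a ≡ m
offset-of-multiple m x y a a≤m eq with y ≤? x
... | yes y≤x = inj₁ (n≤0⇒n≡0 (+-cancelˡ-≤ (x * m) a 0 (begin
      x * m + a ≡⟨ eq ⟩
      y * m     ≤⟨ *-monoˡ-≤ m y≤x ⟩
      x * m     ≡⟨ +-identityʳ (x * m) ⟨
      x * m + 0 ∎)))
  where open ≤-Reasoning
... | no y≰x with m≤n⇒∃[o]m+o≡n (≰⇒> y≰x)
...   | j , refl = inj₂ (≤-antisym a≤m (begin
      m         ≤⟨ m≤m+n m (j * m) ⟩
      m + j * m ≡⟨ +-cancelˡ-≡ (x * m) _ _ (trans (expand x j m) (sym eq)) ⟩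
      a         ∎))
  where
  open ≤-Reasoning
  expand : ∀ x j m → x * m + (m + j * m) ≡ (suc x + j) * m
  expand = solve-∀

strictly-between-multiples : ∀ m x y t → 0 < t → t < m → x * m + t ≢ y * m
strictly-between-multiples m x y t 0<t t<m eq with offset-of-multiple m x y t (<⇒≤ t<m) eq
... | inj₁ refl = <-irrefl refl 0<t
... | inj₂ refl = <-irrefl refl t<m

pred≢self : ∀ {a} → 0 < a → a ∸ 1 ≢ a
pred≢self {suc a} _ e = 1+n≢n (sym e)

pred≢suc : ∀ a → a ∸ 1 ≢ suc a
pred≢suc a e = 1+n≰n (≤-trans (≤-reflexive (sym e)) (m∸n≤m a 1))

shifted-offsets-equal : ∀ m x j a b → a ≤ m → a + 2 * x * m ≡ b + 2 * (x + j) * m → a ≡ b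
shifted-offsets-equal m x j a b a≤m eq = begin
  a                   ≡⟨ a≡ ⟩
  b + (j * m + j * m) ≡⟨ cong (b +_) (cong₂ _+_ jm≡0 jm≡0) ⟩
  b + 0               ≡⟨ +-identityʳ b ⟩
  b                   ∎
  where
  open ≡-Reasoning
  regroup : ∀ b x j m → b + 2 * (x + j) * m ≡ b + (j * m + j * m) + 2 * x * m
  regroup = solve-∀
  a≡ : a ≡ b + (j * m + j * m)
  a≡ = +-cancelʳ-≡ (2 * x * m) _ _ (trans eq (regroup b x j m))
  jm≡0 : j * m ≡ 0
  jm≡0 = double-multiple≤⇒0 j m (≤-trans (m≤n+m _ b) (subst (_≤ m) a≡ a≤m))

even-offsets-equal : ∀ m x y a b → a ≤ m → b ≤ m → a + 2 * x * m ≡ b + 2 * y * m → a ≡ b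
even-offsets-equal m x y a b a≤m b≤m eq with ≤-total x y
... | inj₁ x≤y with m≤n⇒∃[o]m+o≡n x≤y
...   | j , refl = shifted-offsets-equal m x j a b a≤m eq
even-offsets-equal m x y a b a≤m b≤m eq | inj₂ y≤x with m≤n⇒∃[o]m+o≡n y≤x
...   | j , refl = sym (shifted-offsets-equal m y j b a b≤m (sym eq))

full-offsets : ∀ {m a b} → a ≤ m → b ≤ m → m + m ≤ a + b → a ≡ m × b ≡ m
full-offsets {m} {a} {b} a≤m b≤m h =
  ≤-antisym a≤m (+-cancelʳ-≤ b m a (≤-trans (+-monoʳ-≤ m b≤m) h)) ,
  ≤-antisym b≤m (+-cancelˡ-≤ a m b (≤-trans (+-monoˡ-≤ m a≤m) h))

even-sum-offsets-equal : ∀ m x y a b → a ≤ m → b ≤ m → a + b + 2 * x * m ≡ 2 * y * m → a ≡ b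
even-sum-offsets-equal m x y a b a≤m b≤m eq with y ≤? x
... | yes y≤x = trans (m+n≡0⇒m≡0 a a+b≡0) (sym (m+n≡0⇒n≡0 a a+b≡0))
  where
  open ≤-Reasoning
  a+b≡0 : a + b ≡ 0
  a+b≡0 = n≤0⇒n≡0 (+-cancelʳ-≤ (2 * x * m) (a + b) 0 (begin
    a + b + 2 * x * m ≡⟨ eq ⟩
    2 * y * m         ≤⟨ *-monoˡ-≤ m (*-monoʳ-≤ 2 y≤x) ⟩
    2 * x * m         ∎))
... | no y≰x with m≤n⇒∃[o]m+o≡n (≰⇒> y≰x)
...   | j , refl = trans (proj₁ full) (sym (proj₂ full))
  where
  open ≤-Reasoning
  regroup : ∀ x j m → 2 * (suc x + j) * m ≡ m + m + (j * m + j * m) + 2 * x * m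
  regroup = solve-∀
  full : a ≡ m × b ≡ m
  full = full-offsets a≤m b≤m (begin
    m + m                         ≤⟨ m≤m+n (m + m) _ ⟩
    m + m + (j * m + j * m)       ≡⟨ +-cancelʳ-≡ (2 * x * m) _ _ (trans (sym (regroup x j m)) (sym eq)) ⟩
    a + b                         ∎)

double : ∀ k m → k * m + k * m ≡ 2 * k * m
double = solve-∀

balanced-gaps : ∀ A s₁ s₂ K → suc A + s₁ ≡ K →
                (∀ t → suc A ≤ t → t ≤ K + s₂ → A + t ≢ K + K) →
                (∀ t → suc A ≤ t → t ≤ K + s₂ → t + suc (K + s₂) ≢ K + K) → s₁ ≡ s₂
balanced-gaps A s₁ s₂ _ refl left right with <-cmp s₁ s₂
... | tri≈ _ e _ = e
... | tri< s₁<s₂ _ _ = ⊥-elim (left (suc A + s₁ + suc s₁) (≤-trans (m≤m+n (suc A) s₁) (m≤m+n _ (suc s₁)))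
                                    (+-monoʳ-≤ (suc A + s₁) s₁<s₂) (reflect A s₁))
  where
  reflect : ∀ A s → A + (suc A + s + suc s) ≡ suc A + s + (suc A + s)
  reflect = solve-∀
... | tri> _ _ s₂<s₁ with m≤n⇒∃[o]m+o≡n s₂<s₁
...   | r , refl = ⊥-elim (right (suc A + r) (m≤m+n (suc A) r)
                           (≤-trans (+-monoʳ-≤ (suc A) (m≤n+m r (suc s₂))) (m≤m+n _ s₂)) (reflect A r s₂))
  where
  reflect : ∀ A r s → suc A + r + suc (suc A + (suc s + r) + s) ≡ suc A + (suc s + r) + (suc A + (suc s + r))
  reflect = solve-∀

short-gap : ∀ A s k m → suc A + s ≡ k * m →
            (∀ t → suc A ≤ t → t ≤ k * m + s → ∀ i → A + t ≢ 2 * i * m) → s < m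
short-gap A s k m eq forbidden with m ≤? s
... | no m≰s = ≰⇒> m≰s
... | yes m≤s with m≤n⇒∃[o]m+o≡n m≤s
...   | r , refl with k
...     | zero = ⊥-elim (1+n≢0 eq)
...     | suc k′ = ⊥-elim (forbidden (k′ * m + suc r) suc-A≤t t≤ k′ (begin
          A + (k′ * m + suc r)   ≡⟨ shuffle A r (k′ * m) ⟩
          (suc A + r) + k′ * m   ≡⟨ cong (_+ k′ * m) lower ⟨
          k′ * m + k′ * m        ≡⟨ double k′ m ⟩
          2 * k′ * m             ∎))
  where
  open ≡-Reasoning
  shuffle : ∀ A r X → A + (X + suc r) ≡ (suc A + r) + X
  shuffle = solve-∀
  split : ∀ A m r → suc A + (m + r) ≡ m + (suc A + r)
  split = solve-∀
  lower : k′ * m ≡ suc A + r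
  lower = sym (+-cancelˡ-≡ m _ _ (trans (sym (split A m r)) eq))
  m≥1 : 1 ≤ m
  m≥1 = n≢0⇒n>0 (λ m≡0 → 1+n≢0 (trans eq (trans (cong (suc k′ *_) m≡0) (*-zeroʳ (suc k′)))))
  suc-A≤t : suc A ≤ k′ * m + suc r
  suc-A≤t = ≤-trans (m≤m+n (suc A) r) (≤-trans (≤-reflexive (sym lower)) (m≤m+n _ (suc r)))
  t≤ : k′ * m + suc r ≤ suc k′ * m + (m + r)
  t≤ = +-mono-≤ (m≤n+m (k′ * m) m) (+-monoˡ-≤ r m≥1)

bump : Bool → ℕ → ℕ
bump true  n = suc n
bump false n = n

count : (ℕ → Bool) → ℕ → ℕ
count f zero    = zero
count f (suc k) = bump (f k) (count f k)

count-true : ∀ f k → f k ≡ true → count f (suc k) ≡ suc (count f k)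
count-true f k fk rewrite fk = refl

count-false : ∀ f k → f k ≡ false → count f (suc k) ≡ count f k
count-false f k fk rewrite fk = refl

count-≤-suc : ∀ f k → count f k ≤ count f (suc k)
count-≤-suc f k with f k
... | true  = n≤1+n _
... | false = ≤-refl

count-mono : ∀ f {x y} → x ≤ y → count f x ≤ count f y
count-mono f x≤y = go (≤⇒≤′ x≤y)
  where
  go : ∀ {x y} → x ≤′ y → count f x ≤ count f y
  go ≤′-refl         = ≤-refl
  go (≤′-step {y} p) = ≤-trans (go p) (count-≤-suc f y)

crossing : ∀ f x h → h < count f x → ∃[ c ] (c < x × f c ≡ true × count f c ≡ h)
crossing f (suc x) h h<fx with h <? count f x
... | yes h< = let c , c<x , fc , eq = crossing f x h h< in c , m<n⇒m<1+n c<x , fc , eq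
... | no h≮ with f x in fx
...   | true  = x , ≤-refl , fx , ≤-antisym (≮⇒≥ h≮) (≤-pred h<fx)
...   | false = ⊥-elim (h≮ h<fx)

crossing-last : ∀ f c x h → f c ≡ true → count f c ≡ h → count f x ≡ h → x ≤ c
crossing-last f c x h fc ec ex with x ≤? c
... | yes x≤c = x≤c
... | no x≰c = ⊥-elim (<-irrefl refl (begin-strict
      h               ≡⟨ ec ⟨
      count f c       <⟨ ≤-reflexive (sym (count-true f c fc)) ⟩
      count f (suc c) ≤⟨ count-mono f (≰⇒> x≰c) ⟩
      count f x       ≡⟨ ex ⟩
      h               ∎))
  where open ≤-Reasoning

count-hits : ∀ f x t → t ≤ count f x → ∃[ y ] (y ≤ x × count f y ≡ t)
count-hits f x zero    _ = 0 , z≤n , refl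
count-hits f x (suc t) t<fx with crossing f x t t<fx
... | c , c<x , fc , ec = suc c , c<x , trans (count-true f c fc) (cong suc ec)

middle-crossings : ∀ f N h → 0 < h → h < count f N →
  ∃[ c ] ∃[ d ] (f c ≡ true × f d ≡ true × d < N × count f (suc c) ≡ count f d ×
                 (∀ x → count f x ≡ h → suc c ≤ x × x ≤ d))
middle-crossings f N (suc h) _ h<N with crossing f N h (<-trans (n<1+n h) h<N) | crossing f N (suc h) h<N
... | c , _ , fc , count-c | d , d<N , fd , count-d =
  c , d , fc , fd , d<N , trans after-c (sym count-d) , λ x fx → inside x fx , crossing-last f d x (suc h) fd count-d fx
  where
  after-c : count f (suc c) ≡ suc h
  after-c = trans (count-true f c fc) (cong suc count-c)
  inside : ∀ x → count f x ≡ suc h → suc c ≤ x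
  inside x fx with suc c ≤? x
  ... | yes c<x = c<x
  ... | no c≮x = ⊥-elim (1+n≰n (begin
    suc h        ≡⟨ fx ⟨
    count f x    ≤⟨ count-mono f (≤-pred (≰⇒> c≮x)) ⟩
    count f c    ≡⟨ count-c ⟩
    h            ∎))
    where open ≤-Reasoning

flat⇒false : ∀ f x y → count f x ≡ count f y → ∀ z → x ≤ z → z < y → f z ≡ false
flat⇒false f x y eq z x≤z z<y with f z in fz
... | false = refl
... | true = ⊥-elim (<-irrefl refl (begin-strict
      count f x       ≤⟨ count-mono f x≤z ⟩
      count f z       <⟨ ≤-reflexive (sym (count-true f z fz)) ⟩
      count f (suc z) ≤⟨ count-mono f z<y ⟩
      count f y       ≡⟨ eq ⟨
      count f x       ∎))
  where open ≤-Reasoning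

false⇒flat : ∀ f x y → x ≤ y → (∀ z → x ≤ z → z < y → f z ≡ false) → count f x ≡ count f y
false⇒flat f x y x≤y = go (≤⇒≤′ x≤y)
  where
  go : ∀ {y} → x ≤′ y → (∀ z → x ≤ z → z < y → f z ≡ false) → count f x ≡ count f y
  go ≤′-refl         _ = refl
  go (≤′-step {y} p) h = trans (go p (λ z x≤z z<y → h z x≤z (m<n⇒m<1+n z<y)))
                               (sym (count-false f y (h y (≤′⇒≤ p) ≤-refl)))

flat-sub : ∀ f g x y → (∀ i → g i ≡ true → f i ≡ true) → x ≤ y →
           count f x ≡ count f y → count g x ≡ count g y
flat-sub f g x y g⊆f x≤y eq = false⇒flat g x y x≤y (λ z x≤z z<y → g-false z (flat⇒false f x y eq z x≤z z<y))
  where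
  g-false : ∀ z → f z ≡ false → g z ≡ false
  g-false z fz with g z in gz
  ... | false = refl
  ... | true  = trans (sym (g⊆f z gz)) fz

count-front : ∀ f k → count f (suc k) ≡ bump (f 0) (count (λ i → f (suc i)) k)
count-front f zero    = refl
count-front f (suc k) = trans (cong (bump (f (suc k))) (count-front f k)) (bump-comm (f (suc k)) (f 0) _)
  where
  bump-comm : ∀ a b n → bump a (bump b n) ≡ bump b (bump a n)
  bump-comm true  true  n = refl
  bump-comm true  false n = refl
  bump-comm false true  n = refl
  bump-comm false false n = refl

count-complement : ∀ f k → count f k + count (λ i → not (f i)) k ≡ k
count-complement f zero = refl
count-complement f (suc k) with f k
... | true  = cong suc (count-complement f k)
... | false = trans (+-suc _ _) (cong suc (count-complement f k))

-- Walks on the line {0,…,m}.  A quotient map L_n → L_m, read along the line,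
-- is such a walk: it moves by at most one, reaches both ends, and at an
-- interior value it neither rests nor turns back.
record Walk (n m : ℕ) (v : ℕ → ℕ) : Set where
  field
    bounded   : ∀ x → v x ≤ m
    step-up   : ∀ x → v (suc x) ≤ suc (v x)
    step-down : ∀ x → v x ≤ suc (v (suc x))
    straight  : ∀ x → 0 < v x → v x < m → (v (x ∸ 1) ≢ v (suc x)) × (v (suc x) ≢ v x)
    hits-top    : ∃[ x ] (x ≤ n × v x ≡ m)
    hits-bottom : ∃[ x ] (x ≤ n × v x ≡ 0)

rest : (ℕ → ℕ) → ℕ → Bool
rest v y = v y ≡ᵇ v (suc y)

move : (ℕ → ℕ) → ℕ → Bool
move v y = not (rest v y)

≡ᵇ-true⇒≡ : ∀ a b → (a ≡ᵇ b) ≡ true → a ≡ b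
≡ᵇ-true⇒≡ a b h = ≡ᵇ⇒≡ a b (subst T (sym h) _)

≡⇒≡ᵇ-true : ∀ a b → a ≡ b → (a ≡ᵇ b) ≡ true
≡⇒≡ᵇ-true a b e with a ≡ᵇ b in q
... | true  = refl
... | false = ⊥-elim (subst T q (≡⇒≡ᵇ a b e))

≢⇒≡ᵇ-false : ∀ a b → a ≢ b → (a ≡ᵇ b) ≡ false
≢⇒≡ᵇ-false a b ne with a ≡ᵇ b in q
... | false = refl
... | true  = ⊥-elim (ne (≡ᵇ-true⇒≡ a b q))

no-move⇒stay : ∀ v y → move v y ≡ false → v (suc y) ≡ v y
no-move⇒stay v y h with v y ≡ᵇ v (suc y) in q
... | true = sym (≡ᵇ-true⇒≡ _ _ q)

change⇒move : ∀ v y → v (suc y) ≢ v y → move v y ≡ true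
change⇒move v y ne = cong not (≢⇒≡ᵇ-false _ _ (λ e → ne (sym e)))

stay⇒no-move : ∀ v y → v (suc y) ≡ v y → move v y ≡ false
stay⇒no-move v y e = cong not (≡⇒≡ᵇ-true _ _ (sym e))

-- The structure of a walk starting at 0: counting its moves, it consists of
-- sweeps 0 → m → 0 → …, so moves x ≡ v x or moves x ≡ - v x modulo 2m.
module Sweeps {n m : ℕ} {v : ℕ → ℕ} (W : Walk n m v) (v0 : v 0 ≡ 0) where
  open Walk W

  moves : ℕ → ℕ
  moves = count (move v)

  -- In an ascending sweep the last step into an interior value went up, in a
  -- descending one it went down.
  data Phase (x : ℕ) : Set where
    ascending  : ∀ j → moves x ≡ 2 * j * m + v x →
                 (0 < v x → v x < m → suc (v (x ∸ 1)) ≡ v x) → Phase x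
    descending : ∀ j → moves x + v x ≡ 2 * suc j * m →
                 (0 < v x → v x < m → v (x ∸ 1) ≡ suc (v x)) → Phase x

  -- The phase is kept at a rest and along a sweep; the walk can only turn at
  -- an end, where a new sweep begins.
  phase-rest : ∀ x → v (suc x) ≡ v x → Phase x → Phase (suc x)
  phase-rest x same ph = keep ph
    where
    no-change : moves (suc x) ≡ moves x
    no-change = count-false (move v) x (stay⇒no-move v x same)
    extreme : 0 < v (suc x) → v (suc x) < m → ⊥
    extreme p q = proj₂ (straight x (subst (0 <_) same p) (subst (_< m) same q)) same
    keep : Phase x → Phase (suc x)
    keep (ascending j eq _)  = ascending j (trans no-change (trans eq (cong (2 * j * m +_) (sym same))))
                                          (λ p q → ⊥-elim (extreme p q))
    keep (descending j eq _) = descending j (trans (cong₂ _+_ no-change same) eq) (λ p q → ⊥-elim (extreme p q))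

  phase-up : ∀ x → v (suc x) ≡ suc (v x) → Phase x → Phase (suc x)
  phase-up x up ph = go ph
    where
    one-more : moves (suc x) ≡ suc (moves x)
    one-more = count-true (move v) x (change⇒move v x (λ e → 1+n≢n (trans (sym up) e)))
    go : Phase x → Phase (suc x)
    go (ascending j eq _) = ascending j (begin
      moves (suc x)            ≡⟨ one-more ⟩
      suc (moves x)            ≡⟨ cong suc eq ⟩
      suc (2 * j * m + v x)    ≡⟨ +-suc _ (v x) ⟨
      2 * j * m + suc (v x)    ≡⟨ cong (2 * j * m +_) up ⟨
      2 * j * m + v (suc x)    ∎) (λ _ _ → sym up)
      where open ≡-Reasoning
    go (descending j eq came-down) with v x ≟ 0
    ... | yes at-0 = ascending (suc j) (begin
      moves (suc x)                ≡⟨ one-more ⟩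
      suc (moves x)                ≡⟨ cong suc (+-identityʳ _) ⟨
      suc (moves x + 0)            ≡⟨ cong (λ z → suc (moves x + z)) at-0 ⟨
      suc (moves x + v x)          ≡⟨ cong suc eq ⟩
      suc (2 * suc j * m)          ≡⟨ +-comm 1 _ ⟩
      2 * suc j * m + 1            ≡⟨ cong (λ z → 2 * suc j * m + suc z) at-0 ⟨
      2 * suc j * m + suc (v x)    ≡⟨ cong (2 * suc j * m +_) up ⟨
      2 * suc j * m + v (suc x)    ∎) (λ _ _ → sym up)
      where open ≡-Reasoning
    ... | no ≢0 = ⊥-elim (proj₁ (straight x p q) (trans (came-down p q) (sym up)))
      where
      p : 0 < v x
      p = n≢0⇒n>0 ≢0
      q : v x < m
      q = subst (_≤ m) up (bounded (suc x))

  phase-down : ∀ x → v x ≡ suc (v (suc x)) → Phase x → Phase (suc x)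
  phase-down x down ph = go ph
    where
    one-more : moves (suc x) ≡ suc (moves x)
    one-more = count-true (move v) x (change⇒move v x (λ e → 1+n≢n (trans (sym down) (sym e))))
    after : moves (suc x) + v (suc x) ≡ moves x + v x
    after = begin
      moves (suc x) + v (suc x)  ≡⟨ cong (_+ v (suc x)) one-more ⟩
      suc (moves x) + v (suc x)  ≡⟨ +-suc (moves x) _ ⟨
      moves x + suc (v (suc x))  ≡⟨ cong (moves x +_) down ⟨
      moves x + v x              ∎
      where open ≡-Reasoning
    go : Phase x → Phase (suc x)
    go (descending j eq _) = descending j (trans after eq) (λ _ _ → down)
    go (ascending j eq came-up) with m ≟ v x
    ... | yes at-m = descending j (begin
      moves (suc x) + v (suc x)  ≡⟨ after ⟩
      moves x + v x              ≡⟨ cong (_+ v x) eq ⟩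
      2 * j * m + v x + v x      ≡⟨ cong (λ z → 2 * j * m + z + z) at-m ⟨
      2 * j * m + m + m          ≡⟨ sweep j m ⟩
      2 * suc j * m              ∎) (λ _ _ → down)
      where
      open ≡-Reasoning
      sweep : ∀ j m → 2 * j * m + m + m ≡ 2 * suc j * m
      sweep = solve-∀
    ... | no ≢m = ⊥-elim (proj₁ (straight x p q) (suc-injective (trans (came-up p q) down)))
      where
      p : 0 < v x
      p = subst (0 <_) (sym down) z<s
      q : v x < m
      q = ≤∧≢⇒< (bounded x) (λ e → ≢m (sym e))

  phase : ∀ x → Phase x
  phase zero = ascending 0 (sym v0) (λ p _ → ⊥-elim (<-irrefl (sym v0) p))
  phase (suc x) with <-cmp (v (suc x)) (v x)
  ... | tri≈ _ same _ = phase-rest x same (phase x)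
  ... | tri> _ _ gt   = phase-up x (≤-antisym (step-up x) gt) (phase x)
  ... | tri< lt _ _   = phase-down x (≤-antisym (step-down x) lt) (phase x)

  mirror-mixed : ∀ a b j j′ i → moves a ≡ 2 * j * m + v a → moves b + v b ≡ 2 * suc j′ * m →
                 moves a + moves b ≡ 2 * i * m → v a ≡ v b
  mirror-mixed a b j j′ i e₁ e₂ sum =
    even-offsets-equal m (j + suc j′) i (v a) (v b) (bounded a) (bounded b) (begin
      v a + 2 * (j + suc j′) * m                    ≡⟨ regroup (v a) j j′ m ⟩
      (2 * j * m + v a) + 2 * suc j′ * m            ≡⟨ cong₂ _+_ e₁ e₂ ⟨
      moves a + (moves b + v b)                     ≡⟨ +-assoc (moves a) _ _ ⟨
      moves a + moves b + v b                       ≡⟨ cong (_+ v b) sum ⟩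
      2 * i * m + v b                               ≡⟨ +-comm _ (v b) ⟩
      v b + 2 * i * m                               ∎)
    where
    open ≡-Reasoning
    regroup : ∀ a j j′ m → a + 2 * (j + suc j′) * m ≡ (2 * j * m + a) + 2 * suc j′ * m
    regroup = solve-∀

  mirror-equal : ∀ y z i → moves y + moves z ≡ 2 * i * m → v y ≡ v z
  mirror-equal y z i sum with phase y | phase z
  ... | ascending j e₁ _ | ascending j′ e₂ _ =
    even-sum-offsets-equal m (j + j′) i (v y) (v z) (bounded y) (bounded z) (begin
      v y + v z + 2 * (j + j′) * m               ≡⟨ regroup (v y) (v z) j j′ m ⟩
      (2 * j * m + v y) + (2 * j′ * m + v z)     ≡⟨ cong₂ _+_ e₁ e₂ ⟨
      moves y + moves z                          ≡⟨ sum ⟩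
      2 * i * m                                  ∎)
    where
    open ≡-Reasoning
    regroup : ∀ a b j j′ m → a + b + 2 * (j + j′) * m ≡ (2 * j * m + a) + (2 * j′ * m + b)
    regroup = solve-∀
  ... | ascending j e₁ _ | descending j′ e₂ _ = mirror-mixed y z j j′ i e₁ e₂ sum
  ... | descending j e₁ _ | ascending j′ e₂ _ =
    sym (mirror-mixed z y j′ j i e₂ e₁ (trans (+-comm (moves z) (moves y)) sum))
  ... | descending j e₁ _ | descending j′ e₂ _ =
    even-sum-offsets-equal m i (suc j + suc j′) (v y) (v z) (bounded y) (bounded z) (begin
      v y + v z + 2 * i * m                      ≡⟨ cong (v y + v z +_) sum ⟨
      v y + v z + (moves y + moves z)            ≡⟨ regroup (v y) (v z) (moves y) (moves z) ⟩
      (moves y + v y) + (moves z + v z)          ≡⟨ cong₂ _+_ e₁ e₂ ⟩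
      2 * suc j * m + 2 * suc j′ * m             ≡⟨ collect j j′ m ⟩
      2 * (suc j + suc j′) * m                   ∎)
    where
    open ≡-Reasoning
    regroup : ∀ a b c d → a + b + (c + d) ≡ (c + a) + (d + b)
    regroup = solve-∀
    collect : ∀ j j′ m → 2 * suc j * m + 2 * suc j′ * m ≡ 2 * (suc j + suc j′) * m
    collect = solve-∀

  multiple⇒end : ∀ y k → moves y ≡ k * m → v y ≡ 0 ⊎ v y ≡ m
  multiple⇒end y k h with phase y
  ... | ascending j e _  = offset-of-multiple m (2 * j) k (v y) (bounded y) (trans (sym e) h)
  ... | descending j e _ = offset-of-multiple m k (2 * suc j) (v y) (bounded y) (trans (cong (_+ v y) (sym h)) e)

  rest-at-end : ∀ y → v (suc y) ≡ v y → v y ≡ 0 ⊎ v y ≡ m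
  rest-at-end y same with v y ≟ 0 | v y ≟ m
  ... | yes at-0 | _      = inj₁ at-0
  ... | no _     | yes at-m = inj₂ at-m
  ... | no ≢0    | no ≢m  = ⊥-elim (proj₂ (straight y (n≢0⇒n>0 ≢0) (≤∧≢⇒< (bounded y) ≢m)) same)

  rest⇒multiple : ∀ y → move v y ≡ false → ∃[ i ] (moves y ≡ i * m)
  rest⇒multiple y h with rest-at-end y (no-move⇒stay v y h) | phase y
  ... | inj₁ at-0 | ascending j e _  = 2 * j , trans e (trans (cong (2 * j * m +_) at-0) (+-identityʳ _))
  ... | inj₂ at-m | ascending j e _  = suc (2 * j) , trans e (trans (cong (2 * j * m +_) at-m) (+-comm _ m))
  ... | inj₁ at-0 | descending j e _ = 2 * suc j , trans (sym (+-identityʳ _)) (trans (cong (moves y +_) (sym at-0)) e)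
  ... | inj₂ at-m | descending j e _ = suc (2 * j) , +-cancelʳ-≡ m (moves y) _ (begin
      moves y + m          ≡⟨ cong (moves y +_) at-m ⟨
      moves y + v y        ≡⟨ e ⟩
      2 * suc j * m        ≡⟨ split j m ⟩
      suc (2 * j) * m + m  ∎)
    where
    open ≡-Reasoning
    split : ∀ j m → 2 * suc j * m ≡ suc (2 * j) * m + m
    split = solve-∀

  below-multiple⇒move : ∀ y j t → 0 < t → t < m → moves y + t ≡ j * m → move v y ≡ true
  below-multiple⇒move y j t 0<t t<m e with move v y in mv
  ... | true  = refl
  ... | false = let i , ei = rest⇒multiple y mv in
                ⊥-elim (strictly-between-multiples m i j t 0<t t<m (trans (cong (_+ t) (sym ei)) e))

  above-multiple⇒move : ∀ y j t → 0 < t → t < m → moves y ≡ j * m + t → move v y ≡ true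
  above-multiple⇒move y j t 0<t t<m e with move v y in mv
  ... | true  = refl
  ... | false = let i , ei = rest⇒multiple y mv in
                ⊥-elim (strictly-between-multiples m j i t 0<t t<m (trans (sym e) ei))

  run : ∀ p s → (∀ i → i < s → moves (p + i) ≡ moves p + i → move v (p + i) ≡ true) →
        ∀ i → i ≤ s → moves (p + i) ≡ moves p + i
  run p s forced zero    _   = trans (cong moves (+-identityʳ p)) (sym (+-identityʳ _))
  run p s forced (suc i) i<s = begin
    moves (p + suc i)     ≡⟨ cong moves (+-suc p i) ⟩
    moves (suc (p + i))   ≡⟨ count-true (move v) (p + i) (forced i i<s so-far) ⟩
    suc (moves (p + i))   ≡⟨ cong suc so-far ⟩
    suc (moves p + i)     ≡⟨ +-suc (moves p) i ⟨
    moves p + suc i       ∎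
    where
    open ≡-Reasoning
    so-far : moves (p + i) ≡ moves p + i
    so-far = run p s forced i (<⇒≤ i<s)

  moves-injective : ∀ y z → move v y ≡ true → move v z ≡ true → moves y ≡ moves z → y ≡ z
  moves-injective y z my mz eq = ≤-antisym (crossing-last (move v) z y (moves z) mz refl eq)
                                           (crossing-last (move v) y z (moves y) my refl (sym eq))

reflect-step : ∀ m a b → a ≤ suc b → m ∸ b ≤ suc (m ∸ a)
reflect-step zero          a             b       _       = subst (_≤ suc (0 ∸ a)) (sym (0∸n≡0 b)) z≤n
reflect-step (suc m)       zero          b       _       = ≤-trans (m∸n≤m (suc m) b) (n≤1+n _)
reflect-step (suc m)       (suc zero)    zero    _       = ≤-refl
reflect-step (suc m)       (suc (suc a)) zero    (s≤s ())
reflect-step (suc m)       (suc a)       (suc b) (s≤s h) = reflect-step m a b h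

reflect-walk : ∀ {n m v} → Walk n m v → Walk n m (λ x → m ∸ v x)
reflect-walk {n} {m} {v} W = record
  { bounded   = λ x → m∸n≤m m (v x)
  ; step-up   = λ x → reflect-step m (v x) (v (suc x)) (step-down x)
  ; step-down = λ x → reflect-step m (v (suc x)) (v x) (step-up x)
  ; straight  = λ x p q → let no-turn , no-rest = straight x (positive x q) (below-top x p) in
      (λ e → no-turn (cancel (x ∸ 1) (suc x) e)) , (λ e → no-rest (cancel (suc x) x e))
  ; hits-top    = let x , x≤n , at-0 = hits-bottom in x , x≤n , cong (m ∸_) at-0
  ; hits-bottom = let x , x≤n , at-m = hits-top in x , x≤n , trans (cong (m ∸_) at-m) (n∸n≡0 m)
  }
  where
  open Walk W
  cancel : ∀ x y → m ∸ v x ≡ m ∸ v y → v x ≡ v y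
  cancel x y = ∸-cancelˡ-≡ (bounded x) (bounded y)
  positive : ∀ x → m ∸ v x < m → 0 < v x
  positive x q with v x
  ... | zero  = ⊥-elim (<-irrefl refl q)
  ... | suc _ = z<s
  below-top : ∀ x → 0 < m ∸ v x → v x < m
  below-top x p with v x <? m
  ... | yes lt = lt
  ... | no ≮m  = ⊥-elim (<-irrefl (sym (m≤n⇒m∸n≡0 (≮⇒≥ ≮m))) p)

-- A walk from 0 climbs by at most one per step, so the values seen up to x
-- are exactly 0,…,peak x.  Hence the positions where a value is seen for the
-- first time number m + 1 in total; these will be the least elements of the
-- classes of a congruence.
module FirstVisits {n m : ℕ} {w : ℕ → ℕ} (W : Walk n m w) (w0 : w 0 ≡ 0)
                   (first : ℕ → Bool)
                   (seen-before : ∀ x → x ≤ n → ∃[ y ] (y < x × w y ≡ w x) → first x ≡ false)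
                   (new : ∀ x → x ≤ n → (∀ y → y < x → w y ≢ w x) → first x ≡ true) where
  open Walk W

  peak : ℕ → ℕ
  peak zero    = w 0
  peak (suc x) = peak x ⊔ w (suc x)

  below-peak : ∀ x y → y ≤ x → w y ≤ peak x
  below-peak zero    zero _ = ≤-refl
  below-peak (suc x) y y≤x with m≤n⇒m<n∨m≡n y≤x
  ... | inj₂ refl = m≤n⊔m (peak x) (w (suc x))
  ... | inj₁ y<x  = ≤-trans (below-peak x y (≤-pred y<x)) (m≤m⊔n (peak x) (w (suc x)))

  peak-bounded : ∀ x → peak x ≤ m
  peak-bounded zero    = bounded 0
  peak-bounded (suc x) = ⊔-lub (peak-bounded x) (bounded (suc x))

  visited : ∀ x t → t ≤ peak x → ∃[ y ] (y ≤ x × w y ≡ t)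
  visited zero    t h = 0 , z≤n , trans w0 (sym (n≤0⇒n≡0 (subst (t ≤_) w0 h)))
  visited (suc x) t h with t ≤? peak x
  ... | yes t≤ = let y , y≤x , wy = visited x t t≤ in y , m≤n⇒m≤1+n y≤x , wy
  ... | no t≰ = suc x , ≤-refl , ≤-antisym w≤t t≤w
    where
    w≤t : w (suc x) ≤ t
    w≤t = ≤-trans (step-up x) (≤-trans (s≤s (below-peak x x ≤-refl)) (≰⇒> t≰))
    t≤w : t ≤ w (suc x)
    t≤w with peak x ≤? w (suc x)
    ... | yes p≤w = subst (t ≤_) (m≤n⇒m⊔n≡n p≤w) h
    ... | no p≰w  = ⊥-elim (t≰ (subst (t ≤_) (m≥n⇒m⊔n≡m (<⇒≤ (≰⇒> p≰w))) h))

  firsts-up-to : ∀ x → x ≤ n → count first (suc x) ≡ suc (peak x)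
  firsts-up-to zero    h rewrite new 0 h (λ _ ()) = cong suc (sym w0)
  firsts-up-to (suc x) h with w (suc x) ≤? peak x
  ... | yes w≤p = begin
    bump (first (suc x)) (count first (suc x)) ≡⟨ cong (λ b → bump b (count first (suc x))) old ⟩
    count first (suc x)                        ≡⟨ firsts-up-to x (≤-trans (n≤1+n x) h) ⟩
    suc (peak x)                               ≡⟨ cong suc (m≥n⇒m⊔n≡m w≤p) ⟨
    suc (peak x ⊔ w (suc x))                   ∎
    where
    open ≡-Reasoning
    old : first (suc x) ≡ false
    old = seen-before (suc x) h (let y , y≤x , wy = visited x (w (suc x)) w≤p in y , s≤s y≤x , wy)
  ... | no w≰p = begin
    bump (first (suc x)) (count first (suc x)) ≡⟨ cong (λ b → bump b (count first (suc x))) fresh ⟩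
    suc (count first (suc x))                  ≡⟨ cong suc (firsts-up-to x (≤-trans (n≤1+n x) h)) ⟩
    suc (suc (peak x))                         ≡⟨ cong suc (trans (m≤n⇒m⊔n≡n (<⇒≤ (≰⇒> w≰p))) new-peak) ⟨
    suc (peak x ⊔ w (suc x))                   ∎
    where
    open ≡-Reasoning
    new-peak : w (suc x) ≡ suc (peak x)
    new-peak = ≤-antisym (≤-trans (step-up x) (s≤s (below-peak x x ≤-refl))) (≰⇒> w≰p)
    fresh : first (suc x) ≡ true
    fresh = new (suc x) h (λ y y<x e →
      <-irrefl refl (subst (_≤ peak x) (trans e new-peak) (below-peak x y (≤-pred y<x))))

  first-visits : count first (suc n) ≡ suc m
  first-visits = trans (firsts-up-to n ≤-refl) (cong suc (≤-antisym (peak-bounded n)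
    (let x , x≤n , at-top = hits-top in subst (_≤ peak n) at-top (below-peak n x x≤n))))

-- Points of L_n indexed by ℕ: clamp n x is x, or n for x beyond n.
clamp : (n : ℕ) → ℕ → Fin (suc n)
clamp zero    _       = fzero
clamp (suc n) zero    = fzero
clamp (suc n) (suc x) = fsuc (clamp n x)

toℕ-clamp : ∀ n x → x ≤ n → toℕ (clamp n x) ≡ x
toℕ-clamp zero    zero    _       = refl
toℕ-clamp (suc n) zero    _       = refl
toℕ-clamp (suc n) (suc x) (s≤s h) = cong suc (toℕ-clamp n x h)

toℕ-clamp-beyond : ∀ n x → n ≤ x → toℕ (clamp n x) ≡ n
toℕ-clamp-beyond zero    x       _       = refl
toℕ-clamp-beyond (suc n) (suc x) (s≤s h) = cong suc (toℕ-clamp-beyond n x h)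

clamp-0 : ∀ n → clamp n 0 ≡ fzero
clamp-0 zero    = refl
clamp-0 (suc n) = refl

clamp-toℕ : ∀ n (i : Fin (suc n)) → clamp n (toℕ i) ≡ i
clamp-toℕ zero    fzero    = refl
clamp-toℕ (suc n) fzero    = refl
clamp-toℕ (suc n) (fsuc i) = cong fsuc (clamp-toℕ n i)

clamp-adjacent : ∀ n x → Adj (clamp n x) (clamp n (suc x))
clamp-adjacent zero    x       = z≤n , z≤n
clamp-adjacent (suc n) zero    = z≤n , s≤s (at-0 n)
  where
  at-0 : ∀ n → toℕ (clamp n 0) ≤ 0
  at-0 zero    = z≤n
  at-0 (suc n) = z≤n
clamp-adjacent (suc n) (suc x) = let p , q = clamp-adjacent n x in s≤s p , s≤s q

two-neighbours : ∀ t s₁ s₂ → s₁ ≤ suc t → t ≤ suc s₁ → s₂ ≤ suc t → t ≤ suc s₂ →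
                 s₁ ≢ t → s₂ ≢ t → s₁ ≢ s₂ →
                 1 ≤ t × ((s₁ ≡ t ∸ 1 × s₂ ≡ suc t) ⊎ (s₁ ≡ suc t × s₂ ≡ t ∸ 1))
two-neighbours t s₁ s₂ a₁ b₁ a₂ b₂ ne₁ ne₂ ne₁₂ with <-cmp s₁ t | <-cmp s₂ t
... | tri≈ _ e _ | _          = ⊥-elim (ne₁ e)
... | _          | tri≈ _ e _ = ⊥-elim (ne₂ e)
... | tri< l₁ _ _ | tri< l₂ _ _ = ⊥-elim (ne₁₂ (trans (below l₁ b₁) (sym (below l₂ b₂))))
  where
  below : ∀ {s} → s < t → t ≤ suc s → s ≡ t ∸ 1
  below s<t t≤1+s = cong (_∸ 1) (sym (≤-antisym t≤1+s s<t))
... | tri> _ _ g₁ | tri> _ _ g₂ = ⊥-elim (ne₁₂ (trans (≤-antisym a₁ g₁) (sym (≤-antisym a₂ g₂))))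
... | tri< l₁ _ _ | tri> _ _ g₂ =
  ≤-trans (s≤s z≤n) l₁ , inj₁ (cong (_∸ 1) (sym (≤-antisym b₁ l₁)) , ≤-antisym a₂ g₂)
... | tri> _ _ g₁ | tri< l₂ _ _ =
  ≤-trans (s≤s z≤n) l₂ , inj₂ (≤-antisym a₁ g₁ , cong (_∸ 1) (sym (≤-antisym b₂ l₂)))

countB-tabulate : ∀ {A : Set} k (f : Fin k → A) (p : A → Bool) (q : ℕ → Bool) →
                  (∀ i → p (f i) ≡ q (toℕ i)) → countB p (tabulate f) ≡ count q k
countB-tabulate zero    f p q h = refl
countB-tabulate (suc k) f p q h = begin
  (if p (f fzero) then suc tail-count else tail-count) ≡⟨ head (h fzero) ⟩
  bump (q 0) tail-count                                ≡⟨ cong (bump (q 0)) tail ⟩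
  bump (q 0) (count (λ i → q (suc i)) k)               ≡⟨ count-front q k ⟨
  count q (suc k)                                      ∎
  where
  open ≡-Reasoning
  tail-count : ℕ
  tail-count = countB p (tabulate (λ i → f (fsuc i)))
  tail : tail-count ≡ count (λ i → q (suc i)) k
  tail = countB-tabulate k (λ i → f (fsuc i)) p (λ i → q (suc i)) (λ i → h (fsuc i))
  head : ∀ {b c X} → b ≡ c → (if b then suc X else X) ≡ bump c X
  head {true}  refl = refl
  head {false} refl = refl

allB-tabulate⇒ : ∀ {A : Set} k (f : Fin k → A) (p : A → Bool) →
                 allB p (tabulate f) ≡ true → ∀ i → p (f i) ≡ true
allB-tabulate⇒ (suc k) f p h i with p (f fzero) in p0 | i
... | true | fzero  = p0
... | true | fsuc j = allB-tabulate⇒ k (λ j → f (fsuc j)) p h j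

⇒allB-tabulate : ∀ {A : Set} k (f : Fin k → A) (p : A → Bool) →
                 (∀ i → p (f i) ≡ true) → allB p (tabulate f) ≡ true
⇒allB-tabulate zero    f p h = refl
⇒allB-tabulate (suc k) f p h rewrite h fzero = ⇒allB-tabulate k (λ j → f (fsuc j)) p (λ i → h (fsuc i))

T-ext : ∀ {b c} → (T b → T c) → (T c → T b) → b ≡ c
T-ext {true}  {true}  _ _ = refl
T-ext {false} {false} _ _ = refl
T-ext {true}  {false} f _ = ⊥-elim (f _)
T-ext {false} {true}  _ g = ⊥-elim (g _)

module QuotientWalk {n : ℕ} {θ : BRel n} (C : Congruence θ)
                    {m : ℕ} {φ : Fin (suc n) → Fin (suc m)} (Q : QuotIso θ m φ) where
  open Congruence C
  open QuotIso Q

  v : ℕ → ℕ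
  v x = toℕ (φ (clamp n x))

  v-at : ∀ (i : Fin (suc n)) → v (toℕ i) ≡ toℕ (φ i)
  v-at i = cong (λ z → toℕ (φ z)) (clamp-toℕ n i)

  θ-kernel : ∀ a b → θ a b ≡ (toℕ (φ a) ≡ᵇ toℕ (φ b))
  θ-kernel a b = T-ext (λ a~b → ≡⇒≡ᵇ _ _ (cong toℕ (proj₁ (kernel a b) a~b)))
                       (λ eq → proj₂ (kernel a b) (toℕ-injective (≡ᵇ⇒≡ _ _ eq)))

  -- By the back condition, a neighbour j of φ p is the image of a neighbour of p.
  lift-neighbour : ∀ p j → j ≤ m → j ≤ suc (toℕ (φ p)) → toℕ (φ p) ≤ suc j →
                   ∃[ y ] (Adj p y × toℕ (φ y) ≡ j)
  lift-neighbour p j j≤m j≤ ≤j with onto (fromℕ< (s≤s j≤m))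
  ... | y , φy with proj₂ (preserve p y) (subst (λ k → toℕ (φ p) ≤ suc k) (sym φy-j) ≤j ,
                                          subst (_≤ suc (toℕ (φ p))) (sym φy-j) j≤)
    where
    φy-j : toℕ (φ y) ≡ j
    φy-j = trans (cong toℕ φy) (toℕ-fromℕ< (s≤s j≤m))
  ...   | p′ , y′ , p′~p , y′~y , adj with back (sym′ p′~p) adj
  ...     | y″ , adj′ , y″~y′ = y″ , adj′ ,
            trans (cong toℕ (proj₁ (kernel y″ y) (trans′ y″~y′ y′~y)))
                  (trans (cong toℕ φy) (toℕ-fromℕ< (s≤s j≤m)))

  around-interior : ∀ x → 0 < v x → v x < m →
    1 ≤ x × ((v (x ∸ 1) ≡ v x ∸ 1 × v (suc x) ≡ suc (v x)) ⊎
             (v (x ∸ 1) ≡ suc (v x) × v (suc x) ≡ v x ∸ 1))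
  around-interior x 0<a a<m = subst (1 ≤_) t≡x t≥1 , sides (proj₂ shape)
    where
    P : Fin (suc n)
    P = clamp n x
    a : ℕ
    a = v x
    t : ℕ
    t = toℕ P
    up : ∃[ y ] (Adj P y × toℕ (φ y) ≡ suc a)
    up = lift-neighbour P (suc a) a<m ≤-refl (≤-trans (n≤1+n a) (n≤1+n _))
    down : ∃[ y ] (Adj P y × toℕ (φ y) ≡ a ∸ 1)
    down = lift-neighbour P (a ∸ 1) (≤-trans (m∸n≤m a 1) (<⇒≤ a<m)) (≤-trans (m∸n≤m a 1) (n≤1+n a))
                          (m≤n+m∸n a 1)
    y₁ y₂ : Fin (suc n)
    y₁ = proj₁ up
    y₂ = proj₁ down
    apart : ∀ {i j} → toℕ (φ i) ≢ toℕ (φ j) → toℕ i ≢ toℕ j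
    apart ne e = ne (cong (λ z → toℕ (φ z)) (toℕ-injective e))
    φ₁ : toℕ (φ y₁) ≡ suc a
    φ₁ = proj₂ (proj₂ up)
    φ₂ : toℕ (φ y₂) ≡ a ∸ 1
    φ₂ = proj₂ (proj₂ down)
    shape : 1 ≤ t × ((toℕ y₁ ≡ t ∸ 1 × toℕ y₂ ≡ suc t) ⊎ (toℕ y₁ ≡ suc t × toℕ y₂ ≡ t ∸ 1))
    shape = two-neighbours t (toℕ y₁) (toℕ y₂)
              (proj₂ (proj₁ (proj₂ up))) (proj₁ (proj₁ (proj₂ up)))
              (proj₂ (proj₁ (proj₂ down))) (proj₁ (proj₁ (proj₂ down)))
              (apart (λ e → 1+n≢n (trans (sym φ₁) e)))
              (apart (λ e → pred≢self 0<a (trans (sym φ₂) e)))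
              (apart (λ e → pred≢suc a (sym (trans (sym φ₁) (trans e φ₂)))))
    t≥1 : 1 ≤ t
    t≥1 = proj₁ shape
    -- one neighbour is t + 1, so t < n and x ≤ n
    t<n : suc t ≤ n
    t<n with proj₂ shape
    ... | inj₁ (_ , e) = subst (_≤ n) e (≤-pred (toℕ<n y₂))
    ... | inj₂ (e , _) = subst (_≤ n) e (≤-pred (toℕ<n y₁))
    x≤n : x ≤ n
    x≤n with x ≤? n
    ... | yes h = h
    ... | no h  = ⊥-elim (<-irrefl (toℕ-clamp-beyond n x (<⇒≤ (≰⇒> h))) t<n)
    t≡x : t ≡ x
    t≡x = toℕ-clamp n x x≤n
    value-at : ∀ y k → toℕ y ≡ k → v k ≡ toℕ (φ y)
    value-at y k e = trans (cong v (sym e)) (v-at y)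
    sides : (toℕ y₁ ≡ t ∸ 1 × toℕ y₂ ≡ suc t) ⊎ (toℕ y₁ ≡ suc t × toℕ y₂ ≡ t ∸ 1) →
            (v (x ∸ 1) ≡ a ∸ 1 × v (suc x) ≡ suc a) ⊎ (v (x ∸ 1) ≡ suc a × v (suc x) ≡ a ∸ 1)
    sides (inj₁ (e₁ , e₂)) = inj₂ (trans (value-at y₁ _ (trans e₁ (cong (_∸ 1) t≡x))) φ₁ ,
                                   trans (value-at y₂ _ (trans e₂ (cong suc t≡x))) φ₂)
    sides (inj₂ (e₁ , e₂)) = inj₁ (trans (value-at y₂ _ (trans e₂ (cong (_∸ 1) t≡x))) φ₂ ,
                                   trans (value-at y₁ _ (trans e₁ (cong suc t≡x))) φ₁)

  walk : Walk n m v
  walk = record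
    { bounded     = λ x → ≤-pred (toℕ<n (φ (clamp n x)))
    ; step-up     = λ x → proj₂ (steps x)
    ; step-down   = λ x → proj₁ (steps x)
    ; straight    = straight-through
    ; hits-top    = let i , φi = onto (fromℕ m) in
                    toℕ i , ≤-pred (toℕ<n i) , trans (v-at i) (trans (cong toℕ φi) (toℕ-fromℕ m))
    ; hits-bottom = let i , φi = onto fzero in toℕ i , ≤-pred (toℕ<n i) , trans (v-at i) (cong toℕ φi)
    }
    where
    steps : ∀ x → Adj (φ (clamp n x)) (φ (clamp n (suc x)))
    steps x = proj₁ (preserve (clamp n x) (clamp n (suc x)))
                    (clamp n x , clamp n (suc x) , refl′ _ , refl′ _ , clamp-adjacent n x)
    straight-through : ∀ x → 0 < v x → v x < m → (v (x ∸ 1) ≢ v (suc x)) × (v (suc x) ≢ v x)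
    straight-through x p q with around-interior x p q
    ... | _ , inj₁ (e₁ , e₂) = (λ e → pred≢suc (v x) (trans (sym e₁) (trans e e₂))) ,
                               (λ e → 1+n≢n (trans (sym e₂) e))
    ... | _ , inj₂ (e₁ , e₂) = (λ e → pred≢suc (v x) (trans (sym e₂) (trans (sym e) e₁))) ,
                               (λ e → pred≢self p (trans (sym e₂) e))

  -- Reflecting if necessary, the walk starts at 0; this keeps its kernel and its ends.
  record Normalised : Set where
    field
      w        : ℕ → ℕ
      w-walk   : Walk n m w
      w-start  : w 0 ≡ 0
      w-kernel : ∀ x y → (w x ≡ᵇ w y) ≡ (v x ≡ᵇ v y)
      w-ends   : ∀ x → w x ≡ 0 ⊎ w x ≡ m → v x ≡ 0 ⊎ v x ≡ m

  normalise : Normalised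
  normalise with v 0 ≟ 0 | v 0 ≟ m
  ... | yes at-0 | _ = record
    { w = v ; w-walk = walk ; w-start = at-0 ; w-kernel = λ _ _ → refl ; w-ends = λ _ end → end }
  ... | no _ | yes at-m = record
    { w        = λ x → m ∸ v x
    ; w-walk   = reflect-walk walk
    ; w-start  = trans (cong (m ∸_) at-m) (n∸n≡0 m)
    ; w-kernel = λ x y → T-ext (λ eq → ≡⇒≡ᵇ (v x) (v y) (cancel x y (≡ᵇ⇒≡ (m ∸ v x) (m ∸ v y) eq)))
                               (λ eq → ≡⇒≡ᵇ (m ∸ v x) (m ∸ v y) (cong (m ∸_) (≡ᵇ⇒≡ (v x) (v y) eq)))
    ; w-ends   = ends
    }
    where
    open Walk walk using (bounded)
    cancel : ∀ x y → m ∸ v x ≡ m ∸ v y → v x ≡ v y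
    cancel x y = ∸-cancelˡ-≡ (bounded x) (bounded y)
    ends : ∀ x → m ∸ v x ≡ 0 ⊎ m ∸ v x ≡ m → v x ≡ 0 ⊎ v x ≡ m
    ends x (inj₁ e) = inj₂ (≤-antisym (bounded x) (m∸n≡0⇒m≤n e))
    ends x (inj₂ e) = inj₁ (∸-cancelˡ-≡ (bounded x) z≤n e)
  -- an interior value at 0 would need a point before 0
  ... | no ≢0 | no ≢m =
    ⊥-elim (1+n≰n (proj₁ (around-interior 0 (n≢0⇒n>0 ≢0) (≤∧≢⇒< (Walk.bounded walk 0) ≢m))))

  -- Along the normalised walk, the least elements of θ-classes are the first
  -- visits and the rests of θ are the rests of the walk.
  module Counts (N : Normalised) where
    open Normalised N

    θ-on-line : ∀ y x → θ (clamp n y) (clamp n x) ≡ (w y ≡ᵇ w x)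
    θ-on-line y x = trans (θ-kernel _ _) (sym (w-kernel y x))

    θ-along : ∀ (i j : Fin (suc n)) → θ i j ≡ (w (toℕ i) ≡ᵇ w (toℕ j))
    θ-along i j = trans (sym (cong₂ θ (clamp-toℕ n i) (clamp-toℕ n j))) (θ-on-line (toℕ i) (toℕ j))

    first : ℕ → Bool
    first x = isLeader θ (clamp n x)

    no-earlier : Fin (suc n) → Fin (suc n) → Bool
    no-earlier X y = not ((toℕ y <ᵇ toℕ X) ∧ θ y X)

    seen-before : ∀ x → x ≤ n → ∃[ y ] (y < x × w y ≡ w x) → first x ≡ false
    seen-before x x≤n (y , y<x , same) with first x in leader
    ... | false = refl
    ... | true  = sym (subst (λ b → not b ≡ true) (cong₂ _∧_ earlier related)
                             (allB-tabulate⇒ (suc n) (λ i → i) (no-earlier (clamp n x)) leader (clamp n y)))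
      where
      earlier : (toℕ (clamp n y) <ᵇ toℕ (clamp n x)) ≡ true
      earlier = T-ext _ (λ _ → <⇒<ᵇ (subst₂ _<_ (sym (toℕ-clamp n y (≤-trans (<⇒≤ y<x) x≤n)))
                                                 (sym (toℕ-clamp n x x≤n)) y<x))
      related : θ (clamp n y) (clamp n x) ≡ true
      related = trans (θ-on-line y x) (≡⇒≡ᵇ-true _ _ same)

    new : ∀ x → x ≤ n → (∀ y → y < x → w y ≢ w x) → first x ≡ true
    new x x≤n fresh = ⇒allB-tabulate (suc n) (λ i → i) (no-earlier (clamp n x)) test
      where
      test : ∀ i → no-earlier (clamp n x) i ≡ true
      test i with toℕ i <ᵇ toℕ (clamp n x) in lt
      ... | false = refl
      ... | true  = cong not (trans (θ-along i (clamp n x))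
                     (trans (cong (λ k → w (toℕ i) ≡ᵇ w k) (toℕ-clamp n x x≤n))
                            (≢⇒≡ᵇ-false _ _ (fresh (toℕ i) i<x))))
        where
        i<x : toℕ i < x
        i<x = subst (toℕ i <_) (toℕ-clamp n x x≤n) (<ᵇ⇒< _ _ (subst T (sym lt) _))

    classes-count : classes θ ≡ suc m
    classes-count = trans (countB-tabulate (suc n) (λ i → i) (isLeader θ) first
                            (λ i → cong (isLeader θ) (sym (clamp-toℕ n i))))
                          (FirstVisits.first-visits w-walk w-start first seen-before new)

    rests-count : rests θ ≡ count (rest w) n
    rests-count = countB-tabulate n (λ i → i) (λ r → θ (inject₁ r) (fsuc r)) (rest w)
      (λ r → trans (θ-along (inject₁ r) (fsuc r)) (cong (λ k → w k ≡ᵇ w (suc (toℕ r))) (toℕ-inject₁ r)))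

record SweepForm {n : ℕ} (θ : BRel n) : Set where
  field
    m k          : ℕ
    w            : ℕ → ℕ
    walk         : Walk n m w
    start        : w 0 ≡ 0
    total-moves  : count (move w) n ≡ 2 * k * m
    kernel⊆θ     : ∀ y z → w y ≡ w z → θ ∋ clamp n y ~ clamp n z
    end⇒extreme  : ∀ x → w x ≡ 0 ⊎ w x ≡ m → Extreme θ (clamp n x)

-- Any quotient isomorphism, e.g. one witnessing that 0 is an extreme, yields it.
sweep-form : ∀ {n} {θ : BRel n} → Congruence θ → FreqEven θ → Extreme θ fzero → SweepForm θ
sweep-form {n} {θ} C (k , freq) (m , φ , Q , _) = record
  { m = m ; k = k ; w = w ; walk = w-walk ; start = w-start
  ; total-moves = total-moves
  ; kernel⊆θ    = λ y z same → subst T (sym (θ-on-line y z)) (≡⇒≡ᵇ _ _ same)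
  ; end⇒extreme = λ x end → m , φ , Q , w-ends x end
  }
  where
  open QuotientWalk C Q
  open Normalised normalise
  open Counts normalise
  total-moves : count (move w) n ≡ 2 * k * m
  total-moves = begin
    count (move w) n                    ≡⟨ m+n∸m≡n walk-rests _ ⟨
    walk-rests + count (move w) n ∸ walk-rests ≡⟨ cong (_∸ walk-rests) (count-complement (rest w) n) ⟩
    n ∸ walk-rests                      ≡⟨ cong (n ∸_) rests-count ⟨
    n ∸ rests θ                         ≡⟨ freq ⟩
    step θ * (2 * k)                    ≡⟨ cong (λ c → (c ∸ 1) * (2 * k)) classes-count ⟩
    m * (2 * k)                         ≡⟨ *-comm m (2 * k) ⟩
    2 * k * m                           ∎
    where
    open ≡-Reasoning
    walk-rests : ℕ
    walk-rests = count (rest w) n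

CentredLevel : (ℕ → ℕ) → ℕ → ℕ → ℕ → Set
CentredLevel U K c d =
  ∃[ a ] ∃[ e ] (c ≤ a × a ≤ e × e ≤ d × a + e ≡ c + d × (∀ z → a ≤ z → z ≤ e → U z ≡ K))

-- A cut is a step y → y+1 whose ends are
-- not R-related (later R is the join θ ∨ δ).
module Cuts {n m : ℕ} {w : ℕ → ℕ} (W : Walk n m w) (w0 : w 0 ≡ 0)
            (R : ℕ → ℕ → Set)
            (R-refl : ∀ {y} → R y y) (R-sym : ∀ {y z} → R y z → R z y)
            (R-trans : ∀ {x y z} → R x y → R y z → R x z)
            (kernel⊆R : ∀ y z → w y ≡ w z → R y z)
            (R? : ∀ y → Dec (R y (suc y))) where
  open Sweeps W w0

  cut : ℕ → Bool
  cut y = not (does (R? y))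

  cut-true : ∀ y → cut y ≡ true → ¬ R y (suc y)
  cut-true y c with R? y
  ... | no ¬r = ¬r

  cut-false : ∀ y → cut y ≡ false → R y (suc y)
  cut-false y c with R? y
  ... | yes r = r

  -- A cut is a move: at a rest both ends lie in one class of the kernel.
  cut⇒move : ∀ y → cut y ≡ true → move w y ≡ true
  cut⇒move y c with move w y in mv
  ... | true  = refl
  ... | false = ⊥-elim (cut-true y c (kernel⊆R y (suc y) (sym (no-move⇒stay w y mv))))

  mirror-related : ∀ y z i → moves y + moves z ≡ 2 * i * m → R y z
  mirror-related y z i sum = kernel⊆R y z (mirror-equal y z i sum)

  uncut⇒related : ∀ c d → count cut c ≡ count cut d → ∀ z → c ≤ z → z ≤ d → R c z
  uncut⇒related c d flat z c≤z = go (≤⇒≤′ c≤z)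
    where
    go : ∀ {z} → c ≤′ z → z ≤ d → R c z
    go ≤′-refl         _     = R-refl
    go (≤′-step {z} p) 1+z≤d = R-trans (go p (≤-trans (n≤1+n z) 1+z≤d))
                                       (cut-false z (flat⇒false cut c d flat z (≤′⇒≤ p) 1+z≤d))

  crosswise-steps : ∀ c d → R c (suc d) → R (suc c) d → cut c ≡ cut d
  crosswise-steps c d c~d+1 c+1~d with R? c | R? d
  ... | yes _  | yes _  = refl
  ... | no _   | no _   = refl
  ... | yes rc | no ¬rd = ⊥-elim (¬rd (R-trans (R-sym c+1~d) (R-trans (R-sym rc) c~d+1)))
  ... | no ¬rc | yes rd = ⊥-elim (¬rc (R-trans c~d+1 (R-trans (R-sym rd) (R-sym c+1~d))))

  mirrored-steps : ∀ c d i → moves c + moves (suc d) ≡ 2 * i * m → moves (suc c) + moves d ≡ 2 * i * m →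
                   cut c ≡ cut d
  mirrored-steps c d i s₁ s₂ = crosswise-steps c d (mirror-related c (suc d) i s₁) (mirror-related (suc c) d i s₂)

  mirror-cuts : ∀ k → moves n ≡ 2 * k * m →
                ∀ u x x′ → moves x ≡ u → moves x′ + u ≡ moves n → x ≤ n → x′ ≤ n →
                count cut x + count cut x′ ≡ count cut n
  mirror-cuts k total zero x x′ mx mx′ x≤n x′≤n =
    cong₂ _+_ (sym (flat-sub (move w) cut 0 x cut⇒move z≤n (sym mx)))
              (flat-sub (move w) cut x′ n cut⇒move x′≤n (trans (sym (+-identityʳ _)) mx′))
  mirror-cuts k total (suc u) x x′ mx mx′ x≤n x′≤n = begin
    count cut x + count cut x′               ≡⟨ cong₂ _+_ (sym after-c) (sym after-x′) ⟩
    bump (cut c) (count cut c) + count cut d ≡⟨ bump-shift (cut c) _ _ ⟩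
    count cut c + bump (cut c) (count cut d) ≡⟨ cong (λ b → count cut c + bump b (count cut d)) same-step ⟩
    count cut c + count cut (suc d)          ≡⟨ mirror-cuts k total u c (suc d) mc sum-inner c≤n d<n ⟩
    count cut n                              ∎
    where
    open ≡-Reasoning
    bump-shift : ∀ b X Y → bump b X + Y ≡ X + bump b Y
    bump-shift true  X Y = sym (+-suc X Y)
    bump-shift false X Y = refl
    -- c is the move from level u to u + 1 before x, d the move leaving x′'s level.
    crossing-c : ∃[ c ] (c < x × move w c ≡ true × moves c ≡ u)
    crossing-c = crossing (move w) x u (≤-reflexive (sym mx))
    c : ℕ
    c = proj₁ crossing-c
    c<x : c < x
    c<x = proj₁ (proj₂ crossing-c)
    move-c : move w c ≡ true
    move-c = proj₁ (proj₂ (proj₂ crossing-c))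
    mc : moves c ≡ u
    mc = proj₂ (proj₂ (proj₂ crossing-c))
    x′-below : moves x′ < moves n
    x′-below = subst (moves x′ <_) mx′ (m<m+n (moves x′) z<s)
    crossing-d : ∃[ d ] (d < n × move w d ≡ true × moves d ≡ moves x′)
    crossing-d = crossing (move w) n (moves x′) x′-below
    d : ℕ
    d = proj₁ crossing-d
    d<n : d < n
    d<n = proj₁ (proj₂ crossing-d)
    move-d : move w d ≡ true
    move-d = proj₁ (proj₂ (proj₂ crossing-d))
    md : moves d ≡ moves x′
    md = proj₂ (proj₂ (proj₂ crossing-d))
    x′≤d : x′ ≤ d
    x′≤d = crossing-last (move w) d x′ (moves x′) move-d md refl
    msc : moves (suc c) ≡ suc u
    msc = trans (count-true (move w) c move-c) (cong suc mc)
    msd : moves (suc d) ≡ suc (moves x′)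
    msd = trans (count-true (move w) d move-d) (cong suc md)
    sum-inner : moves (suc d) + u ≡ moves n
    sum-inner = trans (cong (_+ u) msd) (trans (sym (+-suc (moves x′) u)) mx′)
    sum₁ : moves c + moves (suc d) ≡ 2 * k * m
    sum₁ = trans (cong (_+ moves (suc d)) mc) (trans (+-comm u _) (trans sum-inner total))
    sum₂ : moves (suc c) + moves d ≡ 2 * k * m
    sum₂ = trans (cong₂ _+_ msc md) (trans (+-comm (suc u) _) (trans mx′ total))
    after-c : bump (cut c) (count cut c) ≡ count cut x
    after-c = flat-sub (move w) cut (suc c) x cut⇒move c<x (trans msc (sym mx))
    after-x′ : count cut d ≡ count cut x′
    after-x′ = sym (flat-sub (move w) cut x′ d cut⇒move x′≤d (sym md))
    same-step : cut c ≡ cut d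
    same-step = mirrored-steps c d k sum₁ sum₂
    c≤n : c ≤ n
    c≤n = ≤-trans (<⇒≤ c<x) x≤n

  -- In the block of R between two cuts c₀ and d, containing a position at
  -- level K = k·m, the move counts of the block, moves c₀ + 1, …, moves d,
  -- surround K evenly and closely: no position of the block may mirror c₀ or
  -- d + 1, since it would then be R-related to a point across a cut.
  block-gap : ∀ k c₀ d x → cut c₀ ≡ true → cut d ≡ true → count cut (suc c₀) ≡ count cut d →
              suc c₀ ≤ x → x ≤ d → moves x ≡ k * m →
              ∃[ s ] (suc (moves c₀) + s ≡ k * m × k * m + s ≡ moves d × s < m)
  block-gap k c₀ d x cut-c₀ cut-d flat c≤x x≤d mx = s , below , above , s<m
    where
    c A D K : ℕ
    c = suc c₀
    A = moves c₀
    D = moves d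
    K = k * m
    mc : moves c ≡ suc A
    mc = count-true (move w) c₀ (cut⇒move c₀ cut-c₀)
    inside : ∀ z → c ≤ z → z ≤ d → R c z
    inside = uncut⇒related c d flat
    attained : ∀ t → suc A ≤ t → t ≤ D → ∃[ z ] (c ≤ z × z ≤ d × moves z ≡ t)
    attained t lo hi with count-hits (move w) d t hi
    ... | z , z≤d , mz with c ≤? z
    ...   | yes c≤z = z , c≤z , z≤d , mz
    ...   | no c≰z  = ⊥-elim (<-irrefl refl (≤-trans lo (≤-trans (≤-reflexive (sym mz))
                                                       (count-mono (move w) (≤-pred (≰⇒> c≰z))))))
    left : ∀ t → suc A ≤ t → t ≤ D → ∀ i → A + t ≢ 2 * i * m
    left t lo hi i eq with attained t lo hi
    ... | z , c≤z , z≤d , mz = cut-true c₀ cut-c₀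
          (R-trans (mirror-related c₀ z i (trans (cong (A +_) mz) eq)) (R-sym (inside z c≤z z≤d)))
    right : ∀ t → suc A ≤ t → t ≤ D → ∀ i → t + suc D ≢ 2 * i * m
    right t lo hi i eq with attained t lo hi
    ... | z , c≤z , z≤d , mz = cut-true d cut-d
          (R-trans (R-trans (R-sym (inside d (≤-trans c≤x x≤d) ≤-refl)) (inside z c≤z z≤d))
                   (mirror-related z (suc d) i
                     (trans (cong₂ _+_ mz (count-true (move w) d (cut⇒move d cut-d))) eq)))
    gap-below : ∃[ s ] (suc A + s ≡ K)
    gap-below = m≤n⇒∃[o]m+o≡n (subst₂ _≤_ mc mx (count-mono (move w) c≤x))
    gap-above : ∃[ s ] (K + s ≡ D)
    gap-above = m≤n⇒∃[o]m+o≡n (subst (_≤ D) mx (count-mono (move w) x≤d))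
    s : ℕ
    s = proj₁ gap-below
    below : suc A + s ≡ K
    below = proj₂ gap-below
    equal-gaps : s ≡ proj₁ gap-above
    equal-gaps = balanced-gaps A s (proj₁ gap-above) K below
      (λ t lo hi eq → left t lo (subst (t ≤_) (proj₂ gap-above) hi) k (trans eq (double k m)))
      (λ t lo hi eq → right t lo (subst (t ≤_) (proj₂ gap-above) hi) k
                        (trans (cong (λ q → t + suc q) (sym (proj₂ gap-above))) (trans eq (double k m))))
    above : K + s ≡ D
    above = trans (cong (K +_) equal-gaps) (proj₂ gap-above)
    s<m : s < m
    s<m = short-gap A s k m below (λ t lo hi i → left t lo (subst (t ≤_) above hi) i)

  -- With these gaps the positions at level k·m form an interval centred in
  -- the block: the walk climbs straight from c₀ + 1 to level k·m and, after
  -- leaving it, descends straight to d, both in s steps.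
  centred-from-gap : ∀ k c₀ d → cut c₀ ≡ true → cut d ≡ true →
                     ∃[ s ] (suc (moves c₀) + s ≡ k * m × k * m + s ≡ moves d × s < m) →
                     CentredLevel moves (k * m) (suc c₀) d
  centred-from-gap k c₀ d cut-c₀ cut-d (s , below , above , s<m) = a , e , m≤m+n c s , a≤e , e≤d , centred , level
    where
    c A K : ℕ
    c = suc c₀
    A = moves c₀
    K = k * m
    mc : moves c ≡ suc A
    mc = count-true (move w) c₀ (cut⇒move c₀ cut-c₀)
    climb : ∀ i → i < s → moves (c + i) ≡ moves c + i → move w (c + i) ≡ true
    climb i i<s so-far with m≤n⇒∃[o]m+o≡n i<s
    ... | r , rest-of-s = below-multiple⇒move (c + i) k (suc r) z<s
                            (≤-<-trans (subst (suc r ≤_) rest-of-s (s≤s (m≤n+m r i))) s<m) (begin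
      moves (c + i) + suc r  ≡⟨ cong (_+ suc r) (trans so-far (cong (_+ i) mc)) ⟩
      suc A + i + suc r      ≡⟨ regroup A i r ⟩
      suc A + (suc i + r)    ≡⟨ cong (suc A +_) rest-of-s ⟩
      suc A + s              ≡⟨ below ⟩
      K                      ∎)
      where
      open ≡-Reasoning
      regroup : ∀ A i r → suc A + i + suc r ≡ suc A + (suc i + r)
      regroup = solve-∀
    a : ℕ
    a = c + s
    ma : moves a ≡ K
    ma = trans (run c s climb s ≤-refl) (trans (cong (_+ s) mc) below)
    leave : ∃[ e ] (e < suc d × move w e ≡ true × moves e ≡ K)
    leave = crossing (move w) (suc d) K
              (subst (K <_) (sym (count-true (move w) d (cut⇒move d cut-d))) (s≤s (subst (K ≤_) above (m≤m+n K s))))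
    e : ℕ
    e = proj₁ leave
    move-e : move w e ≡ true
    move-e = proj₁ (proj₂ (proj₂ leave))
    me : moves e ≡ K
    me = proj₂ (proj₂ (proj₂ leave))
    descend : ∀ i → i < suc s → moves (e + i) ≡ moves e + i → move w (e + i) ≡ true
    descend zero    _     _      = subst (λ q → move w q ≡ true) (sym (+-identityʳ e)) move-e
    descend (suc i) i<1+s so-far =
      above-multiple⇒move (e + suc i) k (suc i) z<s (≤-<-trans (≤-pred i<1+s) s<m) (trans so-far (cong (_+ suc i) me))
    descent : moves (e + s) ≡ moves e + s
    descent = run e (suc s) descend s (n≤1+n s)
    e+s≡d : e + s ≡ d
    e+s≡d = moves-injective (e + s) d (descend s ≤-refl descent) (cut⇒move d cut-d)
                            (trans descent (trans (cong (_+ s) me) above))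
    e≤d : e ≤ d
    e≤d = subst (e ≤_) e+s≡d (m≤m+n e s)
    a≤e : a ≤ e
    a≤e = crossing-last (move w) e a K move-e me ma
    centred : a + e ≡ c + d
    centred = trans (+-assoc c s e) (cong (c +_) (trans (+-comm s e) e+s≡d))
    level : ∀ z → a ≤ z → z ≤ e → moves z ≡ K
    level z a≤z z≤e = ≤-antisym (subst (moves z ≤_) me (count-mono (move w) z≤e))
                                (subst (_≤ moves z) ma (count-mono (move w) a≤z))

  centred-level : ∀ k c₀ d x → cut c₀ ≡ true → cut d ≡ true → count cut (suc c₀) ≡ count cut d →
                  suc c₀ ≤ x → x ≤ d → moves x ≡ k * m → CentredLevel moves (k * m) (suc c₀) d
  centred-level k c₀ d x cut-c₀ cut-d flat c≤x x≤d mx =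
    centred-from-gap k c₀ d cut-c₀ cut-d (block-gap k c₀ d x cut-c₀ cut-d flat c≤x x≤d mx)

¬¬-decide-below : ∀ (P : ℕ → Set) N → ¬ ¬ (∀ y → y < N → Dec (P y))
¬¬-decide-below P zero    k = k (λ _ ())
¬¬-decide-below P (suc N) k =
  ¬¬-decide-below P N (λ below → ¬¬-excluded-middle (λ here → k (extend below here)))
  where
  extend : (∀ y → y < N → Dec (P y)) → Dec (P N) → ∀ y → y < suc N → Dec (P y)
  extend below here y y<1+N with m≤n⇒m<n∨m≡n (≤-pred y<1+N)
  ... | inj₁ y<N = below y y<N
  ... | inj₂ refl = here

common-centre : ∀ a₁ e₁ a₂ e₂ → a₁ ≤ e₁ → a₂ ≤ e₂ → a₁ + e₁ ≡ a₂ + e₂ →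
                ∃[ x ] (a₁ ≤ x × x ≤ e₁ × a₂ ≤ x × x ≤ e₂)
common-centre a₁ e₁ a₂ e₂ a₁≤e₁ a₂≤e₂ same with ≤-total a₁ a₂
... | inj₁ a₁≤a₂ = a₂ , a₁≤a₂ , ≤-trans a₂≤e₂ e₂≤e₁ , ≤-refl , a₂≤e₂
  where
  open ≤-Reasoning
  e₂≤e₁ : e₂ ≤ e₁
  e₂≤e₁ = +-cancelˡ-≤ a₂ e₂ e₁ (begin a₂ + e₂ ≡⟨ same ⟨ a₁ + e₁ ≤⟨ +-monoˡ-≤ e₁ a₁≤a₂ ⟩ a₂ + e₁ ∎)
... | inj₂ a₂≤a₁ = a₁ , ≤-refl , a₁≤e₁ , a₂≤a₁ , ≤-trans a₁≤e₁ e₁≤e₂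
  where
  open ≤-Reasoning
  e₁≤e₂ : e₁ ≤ e₂
  e₁≤e₂ = +-cancelˡ-≤ a₁ e₁ e₂ (begin a₁ + e₁ ≡⟨ same ⟩ a₂ + e₂ ≤⟨ +-monoˡ-≤ e₂ a₂≤a₁ ⟩ a₁ + e₂ ∎)

half-bounds : ∀ {h N} → h + h ≡ N → 0 < N → 0 < h × h < N
half-bounds {zero}  refl ()
half-bounds {suc h} refl _ = z<s , m<m+n (suc h) z<s

half-unique : ∀ a b → a + a ≡ b + b → a ≡ b
half-unique a b eq = trans (n≡⌊n+n/2⌋ a) (trans (cong ⌊_/2⌋ eq) (sym (n≡⌊n+n/2⌋ b)))

module CommonExtreme {n : ℕ} {θ δ : BRel n} (Cθ : Congruence θ) (Cδ : Congruence δ)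
                     (Sθ : SweepForm θ) (Sδ : SweepForm δ) (not-total : ¬ JoinIsTotal θ δ)
                     (decide : ∀ y → y < n → Dec (Join θ δ (clamp n y) (clamp n (suc y)))) where

  Joined : ℕ → ℕ → Set
  Joined x y = Join θ δ (clamp n x) (clamp n y)

  join-sym : ∀ {a b} → Join θ δ a b → Join θ δ b a
  join-sym = reverse flip
    where
    flip : ∀ {a b} → Union θ δ a b → Union θ δ b a
    flip (inl a~b) = inl (Congruence.sym′ Cθ a~b)
    flip (inr a~b) = inr (Congruence.sym′ Cδ a~b)

  -- Beyond n both ends of a step clamp to the same point.
  Joined? : ∀ y → Dec (Joined y (suc y))
  Joined? y with y <? n
  ... | yes y<n = decide y y<n
  ... | no y≮n  = yes (subst (Join θ δ (clamp n y)) same-point ε)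
    where
    same-point : clamp n y ≡ clamp n (suc y)
    same-point = toℕ-injective (trans (toℕ-clamp-beyond n y (≮⇒≥ y≮n))
                                      (sym (toℕ-clamp-beyond n (suc y) (≤-trans (≮⇒≥ y≮n) (n≤1+n y)))))

  module Side {ρ : BRel n} (S : SweepForm ρ) (ρ⊆join : ∀ {a b} → ρ ∋ a ~ b → Union θ δ a b) where
    open SweepForm S public
    open Sweeps walk start public using (moves; multiple⇒end)
    open Cuts walk start Joined ε join-sym _◅◅_ (λ y z same → ρ⊆join (kernel⊆θ y z same) ◅ ε) Joined?
      public using (cut; uncut⇒related; mirror-cuts; centred-level)

    midpoint : ∃[ x ] (x ≤ n × moves x ≡ k * m)
    midpoint = count-hits (move w) n (k * m)
                 (subst (k * m ≤_) (trans (double k m) (sym total-moves)) (m≤m+n (k * m) (k * m)))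

    half-of-cuts : ∀ x → x ≤ n → moves x ≡ k * m → count cut x + count cut x ≡ count cut n
    half-of-cuts x x≤n mx = mirror-cuts k total-moves (k * m) x x mx
                              (trans (cong (_+ k * m) mx) (trans (double k m) (sym total-moves))) x≤n x≤n

    level⇒extreme : ∀ z → moves z ≡ k * m → Extreme ρ (clamp n z)
    level⇒extreme z level = end⇒extreme z (multiple⇒end z k level)

  module θs = Side Sθ inl
  module δs = Side Sδ inr
  open θs using (cut; uncut⇒related)

  -- There is a cut, since otherwise everything would be joined to 0.
  some-cut : 0 < count cut n
  some-cut with count cut n ≟ 0
  ... | no ≢0 = n≢0⇒n>0 ≢0
  ... | yes none = ⊥-elim (not-total (λ X Y → join-sym (from-0 X) ◅◅ from-0 Y))
    where
    from-0 : ∀ X → Join θ δ fzero X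
    from-0 X = subst₂ (Join θ δ) (clamp-0 n) (clamp-toℕ n X)
                 (uncut⇒related 0 n (sym none) (toℕ X) z≤n (≤-pred (toℕ<n X)))

  same-half : ∀ x₁ x₂ → x₁ ≤ n → θs.moves x₁ ≡ θs.k * θs.m → x₂ ≤ n → δs.moves x₂ ≡ δs.k * δs.m →
              count cut x₂ ≡ count cut x₁
  same-half x₁ x₂ x₁≤n mx₁ x₂≤n mx₂ =
    half-unique _ _ (trans (δs.half-of-cuts x₂ x₂≤n mx₂) (sym (θs.half-of-cuts x₁ x₁≤n mx₁)))

  meet-in-block : ∀ c₀ d → d < n →
                  CentredLevel θs.moves (θs.k * θs.m) (suc c₀) d → CentredLevel δs.moves (δs.k * δs.m) (suc c₀) d →
                  ∃[ x ] (1 ≤ x × x < n × Extreme θ (clamp n x) × Extreme δ (clamp n x))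
  meet-in-block c₀ d d<n (a₁ , e₁ , c≤a₁ , a₁≤e₁ , e₁≤d , centre₁ , level₁)
                         (a₂ , e₂ , _ , a₂≤e₂ , _ , centre₂ , level₂) =
    let x , a₁≤x , x≤e₁ , a₂≤x , x≤e₂ = common-centre a₁ e₁ a₂ e₂ a₁≤e₁ a₂≤e₂ (trans centre₁ (sym centre₂)) in
    x , ≤-trans (s≤s z≤n) (≤-trans c≤a₁ a₁≤x) , ≤-<-trans (≤-trans x≤e₁ e₁≤d) d<n ,
    θs.level⇒extreme x (level₁ x a₁≤x x≤e₁) , δs.level⇒extreme x (level₂ x a₂≤x x≤e₂)

  -- Both midpoints lie in the block between the h-th and the (h+1)-th cut,
  -- h being half the number of cuts, where their levels are centred intervals.
  meet-at-midpoints : ∀ x₁ x₂ → x₁ ≤ n → θs.moves x₁ ≡ θs.k * θs.m → x₂ ≤ n → δs.moves x₂ ≡ δs.k * δs.m →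
                      ∃[ x ] (1 ≤ x × x < n × Extreme θ (clamp n x) × Extreme δ (clamp n x))
  meet-at-midpoints x₁ x₂ x₁≤n mx₁ x₂≤n mx₂
    with half-bounds (θs.half-of-cuts x₁ x₁≤n mx₁) some-cut
  ... | 0<h , h<all
    with middle-crossings cut n (count cut x₁) 0<h h<all
  ... | c₀ , d , cut-c₀ , cut-d , d<n , uncut , block = meet-in-block c₀ d d<n
    (θs.centred-level θs.k c₀ d x₁ cut-c₀ cut-d uncut (proj₁ (block x₁ refl)) (proj₂ (block x₁ refl)) mx₁)
    (δs.centred-level δs.k c₀ d x₂ cut-c₀ cut-d uncut (proj₁ (block x₂ same)) (proj₂ (block x₂ same)) mx₂)
    where
    same : count cut x₂ ≡ count cut x₁
    same = same-half x₁ x₂ x₁≤n mx₁ x₂≤n mx₂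

  common-interior-extreme : ∃[ x ] (1 ≤ x × x < n × Extreme θ (clamp n x) × Extreme δ (clamp n x))
  common-interior-extreme with θs.midpoint | δs.midpoint
  ... | x₁ , x₁≤n , mx₁ | x₂ , x₂≤n , mx₂ = meet-at-midpoints x₁ x₂ x₁≤n mx₁ x₂≤n mx₂

interior-not-end : ∀ n x → 1 ≤ x → x < n → ¬ (clamp n x ≡ fzero ⊎ clamp n x ≡ fromℕ n)
interior-not-end n x x≥1 x<n (inj₁ at-0) =
  <-irrefl (trans (cong toℕ (sym at-0)) (toℕ-clamp n x (<⇒≤ x<n))) x≥1
interior-not-end n x x≥1 x<n (inj₂ at-n) =
  <-irrefl (trans (sym (toℕ-clamp n x (<⇒≤ x<n))) (trans (cong toℕ at-n) (toℕ-fromℕ n))) x<n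

lemma5p13 : (n : ℕ) → 1 ≤ n → (θ δ : BRel n) →
    Congruence θ → Congruence δ →
    1 < classes θ → 1 < classes δ →
    ¬ JoinIsTotal θ δ →
    FreqEven θ → FreqEven δ →
    ¬ ExtMeetIsEnds θ δ
-- Assuming ext θ ∩ ext δ = {0, n}: 0 is an extreme of both, so both have a
-- sweep form; deciding the join on the n steps is possible up to double
-- negation, which suffices for a contradiction; the common interior extreme
-- then contradicts the assumption.
lemma5p13 n _ θ δ Cθ Cδ _ _ not-total even-θ even-δ only-ends =
  ¬¬-decide-below (λ y → Join θ δ (clamp n y) (clamp n (suc y))) n λ decide →
    let x , x≥1 , x<n , extreme-θ , extreme-δ =
          CommonExtreme.common-interior-extreme Cθ Cδ
            (sweep-form Cθ even-θ (proj₁ 0-extreme)) (sweep-form Cδ even-δ (proj₂ 0-extreme)) not-total decide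
    in interior-not-end n x x≥1 x<n (proj₁ (only-ends (clamp n x)) (extreme-θ , extreme-δ))
  where
  0-extreme : Extreme θ fzero × Extreme δ fzero
  0-extreme = proj₂ (only-ends fzero) (inj₁ refl)
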